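{- Let $n \geqslant 3$ and let $k$ be a positive integer with $k \geqslant n-3$. Then $$rn_k(C_n) = \begin{cases} \left(\frac{n-2}{2}\right)(2k+3-n) + k - \frac{n}{2} + 1 & \text{if } n \text{ is even},\\ \left(\frac{n-1}{2}\right)(2k+3-n) & \text{if } n \text{ is odd}.\end{cases}$$
   Context: $C_n$ is the cycle on vertex set $\mathbb{Z}_n = \{0,1,\ldots,n-1\}$, with $u,v$ adjacent iff $u \equiv v \pm 1 \pmod n$; $d(u,v)$ is the graph distance. For a positive integer $k$, a radio-$k$-labeling of a graph $G$ is a function $f \colon V(G) \to \{0,1,2,\ldots\}$ such that $|f(u)-f(v)| \geqslant k - d(u,v) + 1$ for all distinct $u,v$. The span of $f$ is $\max\{|f(u)-f(v)| : u,v \in V(G)\}$, and the radio-$k$-number $rn_k(G)$ is the minimum span over all radio-$k$-labelings of $G$. -}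

module Defs where

open import Data.Nat using (ℕ; zero; suc; _+_; _*_; _∸_; _≤_; _⊓_; ∣_-_∣)
open import Data.Fin using (Fin; toℕ)
open import Data.Product using (Σ; ∃; ∃-syntax; _×_)
open import Relation.Binary.PropositionalEquality using (_≡_)
open import Relation.Nullary using (¬_)

cycleDist : (n : ℕ) → Fin n → Fin n → ℕ
cycleDist n u v = ∣ toℕ u - toℕ v ∣ ⊓ (n ∸ ∣ toℕ u - toℕ v ∣)

-- Radio-k-labeling of C_n: |f u - f v| ≥ k - d(u,v) + 1 for distinct u v,
-- written without truncated subtraction as k + 1 ≤ d(u,v) + |f u - f v|.
IsRadioLabeling : (n k : ℕ) → (Fin n → ℕ) → Set
IsRadioLabeling n k f =
  ∀ (u v : Fin n) → ¬ (u ≡ v) → k + 1 ≤ cycleDist n u v + ∣ f u - f v ∣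

SpanAtMost : (n : ℕ) → (Fin n → ℕ) → ℕ → Set
SpanAtMost n f s = ∀ (u v : Fin n) → ∣ f u - f v ∣ ≤ s

SpanAtLeast : (n : ℕ) → (Fin n → ℕ) → ℕ → Set
SpanAtLeast n f s = ∃[ u ] ∃[ v ] (s ≤ ∣ f u - f v ∣)

RadioNumberIs : (n k s : ℕ) → Set
RadioNumberIs n k s =
  (∃[ f ] (IsRadioLabeling n k f × SpanAtMost n f s))
  × (∀ (f : Fin n → ℕ) → IsRadioLabeling n k f → SpanAtLeast n f s)

-- Put K = k + 1, let m = ⌊n/2⌋ be the diameter of C_n and a = K − m ≥ 0.
-- List the vertices by increasing label: consecutive vertices x, y satisfy
-- f y − f x ≥ K − d(x, y) ≥ a, giving span ≥ (n − 1) a, the odd formula.  For even n two consecutive differences cannot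
-- both equal a, since that would force d = m twice and a vertex has only one
-- antipode; so each pair of consecutive differences contributes ≥ 2a + 1.
-- Both bounds are attained by labelling the first ⌈n/2⌉ vertices 0, c, 2c, …
-- and the others a, a + c, a + 2c, …, where c = 2k + 3 − n: the hypothesis
-- k ≥ n − 3 says exactly that c ≥ K − 1, so labels c apart never conflict.
module Submission where

open import Defs
open import Data.Nat using (ℕ; zero; suc; _+_; _*_; _∸_; _≤_; _≥_; _<_; _⊓_; _⊔_; ∣_-_∣; z≤n; s≤s; s≤s⁻¹; _<?_; _≟_)
open import Data.Nat.Properties
open import Data.Nat.Tactic.RingSolver using (solve-∀)
open import Data.Fin using (Fin; toℕ)
open import Data.Fin.Properties using (toℕ-injective; toℕ<n)
open import Data.Product using (_×_; _,_; ∃-syntax)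
open import Data.Sum using (_⊎_; inj₁; inj₂)
open import Data.List using (List; []; _∷_; length; allFin)
open import Data.List.Properties using (length-tabulate)
open import Data.List.Relation.Unary.Linked using (Linked; _∷_)
open import Data.List.Relation.Unary.AllPairs using (_∷_)
open import Data.List.Relation.Unary.All using (_∷_)
open import Data.List.Relation.Unary.Unique.Propositional using (Unique)
open import Data.List.Relation.Unary.Unique.Propositional.Properties using (allFin⁺)
open import Data.List.Relation.Binary.Permutation.Propositional using (↭-sym; ↭⇒↭ₛ)
open import Data.List.Relation.Binary.Permutation.Propositional.Properties using (↭-length)
import Data.List.Relation.Binary.Permutation.Setoid.Properties as PermutationSetoidProperties
import Data.List.Sort as Sort
import Relation.Binary.Construct.On as On
open import Relation.Binary.Definitions using (tri<; tri≈; tri>)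
open import Relation.Binary.PropositionalEquality
open import Relation.Nullary using (yes; no)
open import Relation.Nullary.Negation using (contradiction)
open import Function using (_∘_)

m+n≤o⇒m≤∣n-o∣ : ∀ m {n o} → m + n ≤ o → m ≤ ∣ n - o ∣
m+n≤o⇒m≤∣n-o∣ m {n} {o} le =
  ≤-trans (m+n≤o⇒m≤o∸n m le) (subst (o ∸ n ≤_) (∣-∣-comm o n) (m∸n≤∣m-n∣ o n))

m+n≤o⇒m≤∣o-n∣ : ∀ m {n o} → m + n ≤ o → m ≤ ∣ o - n ∣
m+n≤o⇒m≤∣o-n∣ m {n} {o} le = subst (m ≤_) (∣-∣-comm n o) (m+n≤o⇒m≤∣n-o∣ m le)

arcDist : ℕ → ℕ → ℕ
arcDist n D = D ⊓ (n ∸ D)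

arcDist-pos : ∀ {n D} → 0 < D → D < n → 0 < arcDist n D
arcDist-pos 0<D D<n = ⊓-glb 0<D (m<n⇒0<n∸m D<n)

arcDist-≥ : ∀ {n D e} → e ≤ D → e + D ≤ n → e ≤ arcDist n D
arcDist-≥ {e = e} e≤D e+D≤n = ⊓-glb e≤D (m+n≤o⇒m≤o∸n e e+D≤n)

arcDist-≤ : ∀ {n m} D → n ≤ suc (m + m) → arcDist n D ≤ m
arcDist-≤ {n} {m} D n≤ with D ≤? m
... | yes D≤m = ≤-trans (m⊓n≤m D (n ∸ D)) D≤m
... | no D≰m  = ≤-trans (m⊓n≤n D (n ∸ D))
                  (≤-trans (∸-monoʳ-≤ n (≰⇒> D≰m)) (m≤n+o⇒m∸n≤o n (suc m) n≤))

arcDist≡half⇒≡ : ∀ {m D} → D ≤ m + m → arcDist (m + m) D ≡ m → D ≡ m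
arcDist≡half⇒≡ {m} {D} D≤ eq = ≤-antisym D≤m m≤D
  where
  m≤D : m ≤ D
  m≤D = subst (_≤ D) eq (m⊓n≤m D (m + m ∸ D))
  D≤m : D ≤ m
  D≤m = +-cancelˡ-≤ m D m (begin
    m + D            ≤⟨ +-monoˡ-≤ D (subst (_≤ m + m ∸ D) eq (m⊓n≤n D (m + m ∸ D))) ⟩
    (m + m ∸ D) + D  ≡⟨ m∸n+n≡m D≤ ⟩
    m + m            ∎)
    where open ≤-Reasoning

∣m-n∣≡o⇒m≡o+n⊎n≡o+m : ∀ {m n o} → ∣ m - n ∣ ≡ o → m ≡ o + n ⊎ n ≡ o + m
∣m-n∣≡o⇒m≡o+n⊎n≡o+m {m} {n} eq with ≤-total n m
... | inj₁ n≤m = inj₁ (trans (sym (m∸n+n≡m n≤m)) (cong (_+ n) (trans (sym (m≤n⇒∣n-m∣≡n∸m n≤m)) eq)))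
... | inj₂ m≤n = inj₂ (trans (sym (m∸n+n≡m m≤n)) (cong (_+ m) (trans (sym (m≤n⇒∣m-n∣≡n∸m m≤n)) eq)))

antipode-unique : ∀ {m p q r} → p < m + m → r < m + m →
                  ∣ p - q ∣ ≡ m → ∣ q - r ∣ ≡ m → p ≡ r
antipode-unique {m} {p} {q} {r} p< r< pq qr
  with ∣m-n∣≡o⇒m≡o+n⊎n≡o+m pq | ∣m-n∣≡o⇒m≡o+n⊎n≡o+m qr
... | inj₁ p≡m+q | inj₂ r≡m+q = trans p≡m+q (sym r≡m+q)
... | inj₂ q≡m+p | inj₁ q≡m+r = +-cancelˡ-≡ m p r (trans (sym q≡m+p) q≡m+r)
... | inj₁ p≡m+q | inj₁ q≡m+r =
  contradiction p< (≤⇒≯ (subst (m + m ≤_) (sym (trans p≡m+q (cong (m +_) q≡m+r))) (+-monoʳ-≤ m (m≤m+n m r))))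
... | inj₂ q≡m+p | inj₂ r≡m+q =
  contradiction r< (≤⇒≯ (subst (m + m ≤_) (sym (trans r≡m+q (cong (m +_) q≡m+p))) (+-monoʳ-≤ m (m≤m+n m p))))

radio-from-ordered : ∀ {n k} (g : ℕ → ℕ) →
  (∀ {p q} → p < q → q < n → k + 1 ≤ arcDist n (q ∸ p) + ∣ g p - g q ∣) →
  IsRadioLabeling n k (g ∘ toℕ)
radio-from-ordered g ordered u v u≢v with <-cmp (toℕ u) (toℕ v)
... | tri< u<v _ _ rewrite m≤n⇒∣m-n∣≡n∸m (<⇒≤ u<v) = ordered u<v (toℕ<n v)
... | tri≈ _ u≡v _ = contradiction (toℕ-injective u≡v) u≢v
... | tri> _ _ v<u rewrite ∣-∣-comm (toℕ u) (toℕ v) | ∣-∣-comm (g (toℕ u)) (g (toℕ v))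
                         | m≤n⇒∣m-n∣≡n∸m (<⇒≤ v<u) = ordered v<u (toℕ<n u)

SortedBy : {A : Set} → (A → ℕ) → List A → Set
SortedBy f = Linked (λ x y → f x ≤ f y)

sortBy : ∀ n (f : Fin n → ℕ) → ∃[ xs ] SortedBy f xs × Unique xs × length xs ≡ n
sortBy n f = sort (allFin n) , sort-↗ (allFin n) ,
  Unique-resp-↭ (↭⇒↭ₛ (↭-sym (sort-↭ (allFin n)))) (allFin⁺ n) ,
  trans (↭-length (sort-↭ (allFin n))) (length-tabulate _)
  where
  open Sort (On.decTotalOrder ≤-decTotalOrder f)
  open PermutationSetoidProperties (setoid (Fin n)) using (Unique-resp-↭)

spanAtLeast-sorted : ∀ {n S} (f : Fin (suc n) → ℕ) →
  (∀ x ys → length ys ≡ n → SortedBy f (x ∷ ys) → Unique (x ∷ ys) → ∃[ z ] S + f x ≤ f z) →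
  SpanAtLeast (suc n) f S
spanAtLeast-sorted {n} {S} f spread with sortBy (suc n) f
... | x ∷ ys , sorted , unique , len =
  let z , le = spread x ys (suc-injective len) sorted unique in
  z , x , ≤-trans (m+n≤o⇒m≤o∸n S le) (m∸n≤∣m-n∣ (f z) (f x))

module _ {A : Set} (f : A → ℕ) {a : ℕ}
         (gap : ∀ {x y} → x ≢ y → f x ≤ f y → a + f x ≤ f y) where

  spread-uniform : ∀ x ys → SortedBy f (x ∷ ys) → Unique (x ∷ ys) →
                   ∃[ z ] length ys * a + f x ≤ f z
  spread-uniform x [] _ _ = x , ≤-refl
  spread-uniform x (y ∷ ys) (x≤y ∷ sorted) ((x≢y ∷ _) ∷ unique) =
    let z , le = spread-uniform y ys sorted unique in
    z , (begin
      (a + length ys * a) + f x  ≡⟨ shuffle a (length ys * a) (f x) ⟩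
      length ys * a + (a + f x)  ≤⟨ +-monoʳ-≤ (length ys * a) (gap x≢y x≤y) ⟩
      length ys * a + f y        ≤⟨ le ⟩
      f z                        ∎)
    where
    open ≤-Reasoning
    shuffle : ∀ a s x → (a + s) + x ≡ s + (a + x)
    shuffle = solve-∀

  spread-paired : ∀ {b} →
                  (∀ {x y w} → x ≢ y → x ≢ w → y ≢ w → f x ≤ f y → f y ≤ f w → b + f x ≤ f w) →
                  ∀ j x ys → length ys ≡ suc (j + j) → SortedBy f (x ∷ ys) → Unique (x ∷ ys) →
                  ∃[ z ] j * b + a + f x ≤ f z
  spread-paired gap₂ zero x (y ∷ []) _ (x≤y ∷ _) ((x≢y ∷ _) ∷ _) = y , gap x≢y x≤y
  spread-paired {b} gap₂ (suc j) x (y ∷ w ∷ ys) len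
                (x≤y ∷ y≤w ∷ sorted) ((x≢y ∷ x≢w ∷ _) ∷ (y≢w ∷ _) ∷ unique) =
    let z , le = spread-paired gap₂ j w ys len′ sorted unique in
    z , (begin
      (b + j * b) + a + f x  ≡⟨ shuffle b j a (f x) ⟩
      j * b + a + (b + f x)  ≤⟨ +-monoʳ-≤ (j * b + a) (gap₂ x≢y x≢w y≢w x≤y y≤w) ⟩
      j * b + a + f w        ≤⟨ le ⟩
      f z                    ∎)
    where
    open ≤-Reasoning
    shuffle : ∀ b j a x → (b + j * b) + a + x ≡ (j * b + a) + (b + x)
    shuffle = solve-∀
    len′ : length ys ≡ suc (j + j)
    len′ = trans (suc-injective (suc-injective len)) (+-suc j j)

module RadioGaps {n k : ℕ} (m a : ℕ) (n≤ : n ≤ suc (m + m)) (k+1≡m+a : k + 1 ≡ m + a)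
                 (f : Fin n → ℕ) (radio : IsRadioLabeling n k f) where

  distance-gap : ∀ {x y} → x ≢ y → f x ≤ f y → a + (m ∸ cycleDist n x y) + f x ≤ f y
  distance-gap {x} {y} x≢y fx≤fy = m≤o∸n⇒m+n≤o _ fx≤fy (+-cancelˡ-≤ d _ _ (begin
      d + (a + (m ∸ d))  ≡⟨ regroup ⟩
      m + a              ≡⟨ k+1≡m+a ⟨
      k + 1              ≤⟨ radio x y x≢y ⟩
      d + ∣ f x - f y ∣   ≡⟨ cong (d +_) (m≤n⇒∣m-n∣≡n∸m fx≤fy) ⟩
      d + (f y ∸ f x)    ∎))
    where
    open ≤-Reasoning
    d : ℕ
    d = cycleDist n x y
    regroup : d + (a + (m ∸ d)) ≡ m + a
    regroup = trans (cong (d +_) (+-comm a (m ∸ d)))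
               (trans (sym (+-assoc d (m ∸ d) a)) (cong (_+ a) (m+[n∸m]≡n (arcDist-≤ ∣ toℕ x - toℕ y ∣ n≤))))

  uniform-gap : ∀ {x y} → x ≢ y → f x ≤ f y → a + f x ≤ f y
  uniform-gap x≢y fx≤fy = ≤-trans (+-monoˡ-≤ _ (m≤m+n a _)) (distance-gap x≢y fx≤fy)

spanAtLeast-odd : ∀ {m a k} → k + 1 ≡ m + a → (f : Fin (suc (m + m)) → ℕ) →
                  IsRadioLabeling _ k f → SpanAtLeast _ f (m * (a + a))
spanAtLeast-odd {m} {a} k+1≡m+a f radio = spanAtLeast-sorted f λ x ys len sorted unique →
  let z , le = spread-uniform f uniform-gap x ys sorted unique in
  z , subst (λ s → s + f x ≤ f z) (trans (cong (_* a) len) (double m a)) le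
  where
  open RadioGaps m a ≤-refl k+1≡m+a f radio
  double : ∀ m a → (m + m) * a ≡ m * (a + a)
  double = solve-∀

module EvenGaps {h a k : ℕ} (k+1≡m+a : k + 1 ≡ suc h + a)
                (f : Fin (suc h + suc h) → ℕ) (radio : IsRadioLabeling _ k f) where
  m : ℕ
  m = suc h

  n : ℕ
  n = m + m

  open RadioGaps m a (n≤1+n n) k+1≡m+a f radio

  antipodal : ∀ u v → cycleDist n u v ≡ m → ∣ toℕ u - toℕ v ∣ ≡ m
  antipodal u v = arcDist≡half⇒≡
    (<⇒≤ (≤-<-trans (∣m-n∣≤m⊔n (toℕ u) (toℕ v)) (⊔-lub (toℕ<n u) (toℕ<n v))))

  not-antipodal : ∀ u v → cycleDist n u v ≢ m → 1 ≤ m ∸ cycleDist n u v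
  not-antipodal u v d≢m = m<n⇒0<n∸m (≤∧≢⇒< (arcDist-≤ ∣ toℕ u - toℕ v ∣ (n≤1+n n)) d≢m)

  not-both-antipodal : ∀ {x y w} → x ≢ w → 1 ≤ (m ∸ cycleDist n x y) + (m ∸ cycleDist n y w)
  not-both-antipodal {x} {y} {w} x≢w with cycleDist n x y ≟ m | cycleDist n y w ≟ m
  ... | no xy≢m | _       = ≤-trans (not-antipodal x y xy≢m) (m≤m+n _ _)
  ... | yes _   | no yw≢m = ≤-trans (not-antipodal y w yw≢m) (m≤n+m _ _)
  ... | yes xy  | yes yw  = contradiction
          (toℕ-injective (antipode-unique (toℕ<n x) (toℕ<n w) (antipodal x y xy) (antipodal y w yw))) x≢w

  triple-gap : ∀ {x y w} → x ≢ y → x ≢ w → y ≢ w → f x ≤ f y → f y ≤ f w →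
               suc (a + a) + f x ≤ f w
  triple-gap {x} {y} {w} x≢y x≢w y≢w fx≤fy fy≤fw = begin
    suc (a + a) + f x          ≤⟨ +-monoˡ-≤ (f x) two-gaps ⟩
    (a + e₂) + (a + e₁) + f x  ≡⟨ +-assoc (a + e₂) (a + e₁) (f x) ⟩
    (a + e₂) + (a + e₁ + f x)  ≤⟨ +-monoʳ-≤ (a + e₂) (distance-gap x≢y fx≤fy) ⟩
    (a + e₂) + f y             ≤⟨ distance-gap y≢w fy≤fw ⟩
    f w                        ∎
    where
    open ≤-Reasoning
    e₁ e₂ : ℕ
    e₁ = m ∸ cycleDist n x y
    e₂ = m ∸ cycleDist n y w
    two-gaps : suc (a + a) ≤ (a + e₂) + (a + e₁)
    two-gaps = ≤-trans (≤-reflexive (+-comm 1 (a + a)))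
      (≤-trans (+-monoʳ-≤ (a + a) (not-both-antipodal x≢w)) (≤-reflexive (shuffle a e₁ e₂)))
      where
      shuffle : ∀ a e₁ e₂ → (a + a) + (e₁ + e₂) ≡ (a + e₂) + (a + e₁)
      shuffle = solve-∀

  spanAtLeast-even : SpanAtLeast n f (h * suc (a + a) + a)
  spanAtLeast-even = spanAtLeast-sorted f λ x ys len sorted unique →
    spread-paired f uniform-gap triple-gap h x ys (trans len (+-suc h h)) sorted unique

-- In label order the vertices are 0, t+1, 1, t+2, 2, …: the label alternately
-- rises by a along a jump of length t+1 and by b along a jump of length t, and
-- labels that are not adjacent in this order differ by at least c = a + b.
module Interleaved (t a b : ℕ) where

  c : ℕ
  c = b + a

  label : ℕ → ℕ
  label x with x <? suc t
  ... | yes _ = x * c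
  ... | no _  = (x ∸ suc t) * c + a

  label-low : ∀ {x} → x < suc t → label x ≡ x * c
  label-low {x} x<T with x <? suc t
  ... | yes _   = refl
  ... | no x≮T = contradiction x<T x≮T

  label-high : ∀ j → label (suc t + j) ≡ j * c + a
  label-high j with suc t + j <? suc t
  ... | yes q<T = contradiction q<T (≤⇒≯ (m≤m+n (suc t) j))
  ... | no _    = cong (λ i → i * c + a) (m+n∸m≡n (suc t) j)

  data Side : ℕ → Set where
    low  : ∀ {x} → x < suc t → Side x
    high : ∀ j → Side (suc t + j)

  side : ∀ x → Side x
  side x with x <? suc t
  ... | yes x<T = low x<T
  ... | no x≮T  = subst Side (m+[n∸m]≡n (≮⇒≥ x≮T)) (high (x ∸ suc t))

  module _ {n k : ℕ} (k+1≤1+c : k + 1 ≤ suc c)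
           (far : k + 1 ≤ arcDist n (suc t) + a) (near : k + 1 ≤ arcDist n t + b) where

    radio-by-step : ∀ {p q Δ} → p < q → q < n → c ≤ Δ → k + 1 ≤ arcDist n (q ∸ p) + Δ
    radio-by-step {p} {q} p<q q<n c≤Δ = ≤-trans k+1≤1+c
      (+-mono-≤ (arcDist-pos (m<n⇒0<n∸m p<q) (≤-<-trans (m∸n≤m q p) q<n)) c≤Δ)

    radio-low-high : ∀ {p} j → p < suc t → suc t + j < n →
                     k + 1 ≤ arcDist n (suc t + j ∸ p) + ∣ p * c - (j * c + a) ∣
    radio-low-high {p} j p<T q<n with <-cmp p j
    ... | tri< p<j _ _ = radio-by-step (≤-trans p<T (m≤m+n (suc t) j)) q<n
                           (m+n≤o⇒m≤∣n-o∣ c (≤-trans (*-monoˡ-≤ c p<j) (m≤m+n (j * c) a)))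
    ... | tri≈ _ refl _ rewrite m+n∸n≡m (suc t) p =
      ≤-trans far (+-monoʳ-≤ _ (m+n≤o⇒m≤∣n-o∣ a (≤-reflexive (+-comm a (p * c)))))
    ... | tri> _ _ j<p with m≤n⇒m<n∨m≡n j<p
    ...   | inj₂ refl rewrite m+n∸n≡m t j =
      ≤-trans near (+-monoʳ-≤ _ (m+n≤o⇒m≤∣o-n∣ b (≤-reflexive (shuffle a b (j * c)))))
      where
      shuffle : ∀ a b x → b + (x + a) ≡ (b + a) + x
      shuffle = solve-∀
    ...   | inj₁ 1+j<p = radio-by-step (≤-trans p<T (m≤m+n (suc t) j)) q<n (m+n≤o⇒m≤∣o-n∣ c (begin
      c + (j * c + a)  ≤⟨ +-monoʳ-≤ c (+-monoʳ-≤ (j * c) (m≤n+m a b)) ⟩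
      c + (j * c + c)  ≡⟨ cong (c +_) (+-comm (j * c) c) ⟩
      c + (c + j * c)  ≤⟨ *-monoˡ-≤ c 1+j<p ⟩
      p * c            ∎))
      where open ≤-Reasoning

    radio-ordered : ∀ {p q} → p < q → q < n → k + 1 ≤ arcDist n (q ∸ p) + ∣ label p - label q ∣
    radio-ordered {p} {q} p<q q<n with side p | side q
    ... | _ | low q<T rewrite label-low q<T | label-low (<-trans p<q q<T) =
      radio-by-step p<q q<n (m+n≤o⇒m≤∣n-o∣ c (*-monoˡ-≤ c p<q))
    ... | low p<T | high j rewrite label-low p<T | label-high j = radio-low-high j p<T q<n
    ... | high i | high j rewrite label-high i | label-high j =
      radio-by-step p<q q<n (m+n≤o⇒m≤∣n-o∣ c (begin
        c + (i * c + a)  ≡⟨ +-assoc c (i * c) a ⟨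
        c + i * c + a    ≤⟨ +-monoˡ-≤ a (*-monoˡ-≤ c (+-cancelˡ-< (suc t) i j p<q)) ⟩
        j * c + a        ∎))
      where open ≤-Reasoning

    label-radio : IsRadioLabeling n k (label ∘ toℕ)
    label-radio = radio-from-ordered label radio-ordered

  label-bound : ∀ {s x} → x < suc t + suc s → label x ≤ t * c ⊔ (s * c + a)
  label-bound {s} {x} x< with side x
  ... | low x<T rewrite label-low x<T = ≤-trans (*-monoˡ-≤ c (s≤s⁻¹ x<T)) (m≤m⊔n _ _)
  ... | high j rewrite label-high j =
    ≤-trans (+-monoˡ-≤ a (*-monoˡ-≤ c (s≤s⁻¹ (+-cancelˡ-< (suc t) j (suc s) x<)))) (m≤n⊔m _ _)

  label-span : ∀ {n s} → n ≤ suc t + suc s → SpanAtMost n (label ∘ toℕ) (t * c ⊔ (s * c + a))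
  label-span {s = s} n≤ u v =
    ≤-trans (∣m-n∣≤m⊔n (label (toℕ u)) (label (toℕ v))) (⊔-lub (bounded u) (bounded v))
    where
    bounded : ∀ w → label (toℕ w) ≤ t * c ⊔ (s * c + a)
    bounded w = label-bound (≤-trans (toℕ<n w) n≤)

radioNumber-even : ∀ {h a k} → h ≤ suc a → k + 1 ≡ suc h + a →
                   RadioNumberIs (suc h + suc h) k (h * suc (a + a) + a)
radioNumber-even {h} {a} {k} h≤1+a k+1≡ =
  (label ∘ toℕ , label-radio step far near , span) , EvenGaps.spanAtLeast-even k+1≡
  where
  open Interleaved h a (suc a)
  open ≤-Reasoning
  step : k + 1 ≤ suc c
  step = begin
    k + 1              ≡⟨ k+1≡ ⟩
    suc h + a          ≤⟨ +-monoˡ-≤ a (s≤s h≤1+a) ⟩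
    suc (suc a) + a    ∎
  far : k + 1 ≤ arcDist (suc h + suc h) (suc h) + a
  far = ≤-trans (≤-reflexive k+1≡) (+-monoˡ-≤ a (arcDist-≥ ≤-refl ≤-refl))
  near : k + 1 ≤ arcDist (suc h + suc h) h + suc a
  near = begin
    k + 1                                ≡⟨ k+1≡ ⟩
    suc h + a                            ≡⟨ +-suc h a ⟨
    h + suc a                            ≤⟨ +-monoˡ-≤ (suc a) (arcDist-≥ ≤-refl (+-mono-≤ (n≤1+n h) (n≤1+n h))) ⟩
    arcDist (suc h + suc h) h + suc a    ∎
  span : SpanAtMost _ (label ∘ toℕ) (h * suc (a + a) + a)
  span = subst (SpanAtMost _ (label ∘ toℕ)) (m≤n⇒m⊔n≡n (m≤m+n (h * c) a)) (label-span ≤-refl)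

radioNumber-odd : ∀ {h a k} → h ≤ a → k + 1 ≡ suc h + a →
                  RadioNumberIs (suc (suc h + suc h)) k (suc h * (a + a))
radioNumber-odd {h} {a} {k} h≤a k+1≡ =
  (label ∘ toℕ , label-radio step far near , span) , spanAtLeast-odd k+1≡
  where
  open Interleaved (suc h) a a
  step : k + 1 ≤ suc c
  step = ≤-trans (≤-reflexive k+1≡) (s≤s (+-monoˡ-≤ a h≤a))
  far : k + 1 ≤ arcDist (suc (suc h + suc h)) (suc (suc h)) + a
  far = ≤-trans (≤-reflexive k+1≡)
          (+-monoˡ-≤ a (arcDist-≥ (n≤1+n (suc h)) (≤-reflexive (+-suc (suc h) (suc h)))))
  near : k + 1 ≤ arcDist (suc (suc h + suc h)) (suc h) + a
  near = ≤-trans (≤-reflexive k+1≡) (+-monoˡ-≤ a (arcDist-≥ ≤-refl (n≤1+n _)))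
  span : SpanAtMost _ (label ∘ toℕ) (suc h * (a + a))
  span = subst (SpanAtMost _ (label ∘ toℕ))
    (m≥n⇒m⊔n≡m (≤-trans (+-monoʳ-≤ (h * c) (m≤m+n a a)) (≤-reflexive (+-comm (h * c) c))))
    (label-span {s = h} ≤-refl)

m+m≤1+n⇒m≤n : ∀ m {n} → m + m ≤ suc n → m ≤ n
m+m≤1+n⇒m≤n zero    _         = z≤n
m+m≤1+n⇒m≤n (suc m) (s≤s le) = ≤-trans (m≤n+m (suc m) m) le

radioNumber-even-formula : ∀ h k → h + h ≤ suc k →
  RadioNumberIs (suc h + suc h) k (h * (2 * k + 3 ∸ (suc h + suc h)) + (k + 1 ∸ suc h))
radioNumber-even-formula h k h+h≤1+k with k ∸ h | m+[n∸m]≡n (m+m≤1+n⇒m≤n h h+h≤1+k)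
... | a | refl = subst (RadioNumberIs (suc h + suc h) (h + a)) (sym span≡)
                   (radioNumber-even h≤1+a k+1≡)
  where
  k+1≡ : h + a + 1 ≡ suc h + a
  k+1≡ = +-comm (h + a) 1
  h≤1+a : h ≤ suc a
  h≤1+a = +-cancelˡ-≤ h h (suc a) (subst (h + h ≤_) (sym (+-suc h a)) h+h≤1+k)
  span≡ : h * (2 * (h + a) + 3 ∸ (suc h + suc h)) + (h + a + 1 ∸ suc h) ≡ h * suc (a + a) + a
  span≡ = cong₂ (λ x y → h * x + y)
    (trans (cong (_∸ (suc h + suc h)) (expand h a)) (m+n∸m≡n (suc h + suc h) (suc (a + a))))
    (trans (cong (_∸ suc h) k+1≡) (m+n∸m≡n (suc h) a))
    where
    expand : ∀ h a → 2 * (h + a) + 3 ≡ (suc h + suc h) + suc (a + a)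
    expand = solve-∀

radioNumber-odd-formula : ∀ h k → h + h ≤ k →
  RadioNumberIs (suc (suc h + suc h)) k (suc h * (2 * k + 3 ∸ suc (suc h + suc h)))
radioNumber-odd-formula h k h+h≤k with k ∸ h | m+[n∸m]≡n (m+n≤o⇒m≤o h h+h≤k)
... | a | refl = subst (RadioNumberIs (suc (suc h + suc h)) (h + a)) (sym span≡)
                   (radioNumber-odd h≤a (+-comm (h + a) 1))
  where
  h≤a : h ≤ a
  h≤a = +-cancelˡ-≤ h h a h+h≤k
  span≡ : suc h * (2 * (h + a) + 3 ∸ suc (suc h + suc h)) ≡ suc h * (a + a)
  span≡ = cong (suc h *_)
    (trans (cong (_∸ suc (suc h + suc h)) (expand h a)) (m+n∸m≡n (suc (suc h + suc h)) (a + a)))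
    where
    expand : ∀ h a → 2 * (h + a) + 3 ≡ suc (suc h + suc h) + (a + a)
    expand = solve-∀

theorem3p2 : ∀ (n k : ℕ) → n ≥ 3 → k ≥ 1 → k ≥ n ∸ 3 →
      (∀ (m : ℕ) → n ≡ 2 * m →
         RadioNumberIs n k ((m ∸ 1) * (2 * k + 3 ∸ n) + (k + 1 ∸ m)))
    × (∀ (m : ℕ) → n ≡ 2 * m + 1 →
         RadioNumberIs n k (m * (2 * k + 3 ∸ n)))
theorem3p2 n k n≥3 _ k≥n∸3 = even , odd
  where
  n≤3+k : n ≤ 3 + k
  n≤3+k = ≤-trans (m≤n+m∸n n 3) (+-monoʳ-≤ 3 k≥n∸3)

  even : ∀ m → n ≡ 2 * m → RadioNumberIs n k ((m ∸ 1) * (2 * k + 3 ∸ n) + (k + 1 ∸ m))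
  even zero    n≡0  = contradiction (subst (3 ≤_) n≡0 n≥3) λ ()
  even (suc h) n≡2m = subst (λ n → RadioNumberIs n k (h * (2 * k + 3 ∸ n) + (k + 1 ∸ suc h)))
    (sym n≡) (radioNumber-even-formula h k h+h≤1+k)
    where
    n≡ : n ≡ suc h + suc h
    n≡ = trans n≡2m (cong (suc h +_) (+-identityʳ (suc h)))
    h+h≤1+k : h + h ≤ suc k
    h+h≤1+k = +-cancelˡ-≤ 2 _ _ (subst (_≤ 3 + k) (trans n≡ (cong suc (+-suc h h))) n≤3+k)

  odd : ∀ m → n ≡ 2 * m + 1 → RadioNumberIs n k (m * (2 * k + 3 ∸ n))
  odd zero    n≡1    = contradiction (subst (3 ≤_) n≡1 n≥3) λ { (s≤s ()) }
  odd (suc h) n≡2m+1 = subst (λ n → RadioNumberIs n k (suc h * (2 * k + 3 ∸ n)))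
    (sym n≡) (radioNumber-odd-formula h k h+h≤k)
    where
    n≡ : n ≡ suc (suc h + suc h)
    n≡ = trans n≡2m+1 (trans (+-comm (2 * suc h) 1) (cong (λ x → suc (suc h + x)) (+-identityʳ (suc h))))
    h+h≤k : h + h ≤ k
    h+h≤k = +-cancelˡ-≤ 3 _ _ (subst (_≤ 3 + k) (trans n≡ (cong (suc ∘ suc) (+-suc h h))) n≤3+k)
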